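{- Let $B$ be the set of critical densities of proper minor-closed classes of graphs. For $x \geq 0$ let $\delta_B(x) = \inf\{\beta \in B : \beta > x\} - x$ (the gap above $x$ in $B$). Then $\delta_B(x) = O(x^{ -2})$ as $x \to \infty$.
   Context: All graphs are finite and simple. For a graph $G$, $v(G)$ and $e(G)$ denote its numbers of vertices and edges, and its density is $\rho(G)=e(G)/v(G)$. A class of graphs is closed under isomorphism; it is proper if it is non-empty and does not contain all graphs; it is minor-closed if it contains every minor of each of its members (minors are simple graphs: loops and multiple edges created by contractions are discarded). For a class $\mathcal{A}$, $\beta_{\mathcal{A}} = \sup_{G\in\mathcal{A}} \rho(G)$ is its critical density, and $B=\{\beta_{\mathcal{A}} : \mathcal{A} \text{ a proper minor-closed class of graphs}\}$.
   Formalization: The variable $x$ in the gap bound ranges over the rationals. -}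

module Defs where

open import Data.Nat using (ℕ; zero; suc)
import Data.Nat as ℕ
open import Data.Bool using (Bool; true; false; _∧_; _∨_; not; if_then_else_)
open import Data.Fin using (Fin; zero; suc; punchIn)
open import Data.Fin.Properties using (_≟_; _<?_)
open import Data.Product using (Σ; _×_; _,_; ∃)
open import Relation.Nullary using (¬_)
open import Relation.Nullary.Decidable using (⌊_⌋)
open import Relation.Binary.PropositionalEquality using (_≡_)
open import Relation.Binary.Construct.Closure.ReflexiveTransitive using (Star)
open import Function.Bundles using (_↔_; Inverse)
open import Data.Integer using (+_)
open import Data.Rational using (ℚ; _/_; _*_; _+_; _≤_; _<_)

-- A graph has vertex set Fin n.  It is given by an arbitrary Boolean
-- "raw adjacency" function; the actual (simple) edge relation is its
-- symmetrisation with loops removed (edge).  Different raw functions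
-- may describe the same simple graph; this is harmless since all
-- notions below (classes, minors) are taken up to isomorphism of the
-- simple graphs, which only looks at 'edge'.

Adj : ℕ → Set
Adj n = Fin n → Fin n → Bool

record Graph : Set where
  constructor mkGraph
  field
    n   : ℕ
    adj : Adj n

open Graph public

edgeA : ∀ {n} → Adj n → Fin n → Fin n → Bool
edgeA a i j = not ⌊ i ≟ j ⌋ ∧ (a i j ∨ a j i)

edge : (G : Graph) → Fin (n G) → Fin (n G) → Bool
edge G = edgeA (adj G)

v : Graph → ℕ
v G = n G

sumFin : ∀ {k} → (Fin k → ℕ) → ℕ
sumFin {zero}  f = 0
sumFin {suc k} f = f zero ℕ.+ sumFin (λ i → f (suc i))

e : Graph → ℕ
e G = sumFin λ i → sumFin λ j →
        if ⌊ i <? j ⌋ ∧ edge G i j then 1 else 0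

_≅_ : Graph → Graph → Set
G ≅ H = Σ (Fin (n G) ↔ Fin (n H)) λ f →
          ∀ i j → edge H (Inverse.to f i) (Inverse.to f j) ≡ edge G i j

deleteVertex : ∀ {k} → Adj (suc k) → Fin (suc k) → Graph
deleteVertex {k} a x = mkGraph k (λ i j → a (punchIn x i) (punchIn x j))

deleteEdge : ∀ {k} → Adj k → Fin k → Fin k → Graph
deleteEdge {k} a x y = mkGraph k (λ i j →
  edgeA a i j ∧ not ((⌊ i ≟ x ⌋ ∧ ⌊ j ≟ y ⌋) ∨ (⌊ i ≟ y ⌋ ∧ ⌊ j ≟ x ⌋)))

-- contract the edge {x,y}: vertex y is removed and its neighbours become
-- neighbours of x; loops / parallel edges are discarded automatically
-- (edge relation is simple by construction).
contractEdge : ∀ {k} → Adj (suc k) → Fin (suc k) → Fin (suc k) → Graph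
contractEdge {k} a x y = mkGraph k (λ i j →
  edgeA a (punchIn y i) (punchIn y j)
  ∨ (⌊ punchIn y i ≟ x ⌋ ∧ edgeA a y (punchIn y j)))

data MinorStep : Graph → Graph → Set where
  delV : ∀ {k} (a : Adj (suc k)) (x : Fin (suc k)) →
         MinorStep (mkGraph (suc k) a) (deleteVertex a x)
  delE : ∀ {k} (a : Adj k) (x y : Fin k) → edgeA a x y ≡ true →
         MinorStep (mkGraph k a) (deleteEdge a x y)
  conE : ∀ {k} (a : Adj (suc k)) (x y : Fin (suc k)) → edgeA a x y ≡ true →
         MinorStep (mkGraph (suc k) a) (contractEdge a x y)

_≼_ : Graph → Graph → Set
H ≼ G = Σ Graph λ H' → Star MinorStep G H' × (H' ≅ H)

Class : Set₁
Class = Graph → Set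

IsoClosed : Class → Set
IsoClosed A = ∀ G H → G ≅ H → A G → A H

Proper : Class → Set
Proper A = (Σ Graph A) × (Σ Graph λ G → ¬ A G)

MinorClosed : Class → Set
MinorClosed A = ∀ G H → H ≼ G → A G → A H

ProperMinorClosed : Class → Set
ProperMinorClosed A = IsoClosed A × Proper A × MinorClosed A

-- Densities, compared with rationals (avoids reals)

ℕ→ℚ : ℕ → ℚ
ℕ→ℚ m = (+ m) / 1

-- ρ(G) > x   (i.e.  e(G) > x · v(G); false for the null graph)
DensityAbove : ℚ → Graph → Set
DensityAbove x G = x * ℕ→ℚ (v G) < ℕ→ℚ (e G)

DensityAtMost : ℚ → Graph → Set
DensityAtMost y G = ℕ→ℚ (e G) ≤ y * ℕ→ℚ (v G)

CritAbove : Class → ℚ → Set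
CritAbove A x = Σ Graph λ G → A G × DensityAbove x G

CritAtMost : Class → ℚ → Set
CritAtMost A y = ∀ G → A G → DensityAtMost y G

-- β_A ≤ x + ε + C / x²  (for x > 0), written without division:
--   for all G ∈ A,  e(G)·x² ≤ ((x + ε)·x² + C)·v(G)
CritWithinGap : Class → (x ε C : ℚ) → Set
CritWithinGap A x ε C =
  ∀ G → A G → ℕ→ℚ (e G) * (x * x) ≤ ((x + ε) * (x * x) + C) * ℕ→ℚ (v G)

-- For x = p / q ≥ 1 let a = ⌊x⌋ + 1 and consider the graphs on at most N vertices having a vertex
-- cover of size a. Deleting or contracting carries a vertex cover to a vertex cover, so this class is
-- minor-closed. A graph on v vertices with such a cover has at most Σ_{i<v} min(i, a) edges, with
-- equality for the complete split graph, and this bound divided by v increases with v. The critical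
-- density of the class is therefore a − a (a + 1) / (2 N), and the least N for which it exceeds x
-- puts it within 1 / N ≤ 2 / x² of x.
module Submission where

open import Defs
open import Data.Nat using (ℕ; suc; z≤n; s≤s)
open import Data.Nat.Coprimality using (Coprime)

module VertexCovers where

  open import Data.Nat using (ℕ; zero; suc; _+_; _*_; _⊓_; _≤_; z≤n; s≤s; s≤s⁻¹)
  open import Data.Nat.Properties
    using (module ≤-Reasoning; ≤-refl; ≤-reflexive; ≤-trans; +-mono-≤; m≤n+m; n≤1+n; ⊓-glb; 1+n≰n;
           m≤n⇒m⊓n≡m; m≥n⇒m⊓n≡n; +-monoʳ-≤; +-monoˡ-≤; *-monoʳ-≤; *-monoˡ-≤; ⊓-monoˡ-≤;
           *-comm; *-distribˡ-+; m≤n⇒m<n∨m≡n; *-cancelʳ-≤)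
  open import Data.Bool using (Bool; true; false; _∧_; _∨_; not; if_then_else_)
  open import Data.Bool.Properties using (∧-conicalˡ; ∧-conicalʳ; ∨-comm; T-≡)
  open import Data.Fin using (Fin; zero; suc; punchIn; punchOut; _↑ʳ_)
  open import Data.Fin.Properties
    using (_≟_; _<?_; any?; suc-injective; punchIn-injective; punchInᵢ≢i; punchIn-punchOut)
  open import Data.Fin.Permutation using (↔⇒≡)
  open import Data.Maybe using (Maybe; just; nothing; _>>=_; fromMaybe)
  open import Data.Maybe.Properties using (≡-dec)
  open import Data.Product using (Σ; ∃; _×_; _,_; proj₁)
  open import Data.Sum using (_⊎_; inj₁; inj₂) renaming (map to map⊎)
  open import Data.Empty using (⊥-elim)
  open import Relation.Nullary using (¬_; yes; no; Dec)
  open import Relation.Nullary.Decidable using (⌊_⌋; isYes≗does; does-⇔; dec-true; toWitness)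
  open import Relation.Binary.PropositionalEquality
  open import Relation.Binary.Construct.Closure.ReflexiveTransitive using (Star; ε; _◅_)
  open import Function using (_∘_; _⇔_; mk⇔)
  open import Function.Bundles using (Inverse; Equivalence)
  open import Data.Nat.Solver using (module +-*-Solver)
  open +-*-Solver using (solve; _:+_; _:*_; _:=_; con)

  ⌊⌋-⇔ : ∀ {A B : Set} → A ⇔ B → (a? : Dec A) (b? : Dec B) → ⌊ a? ⌋ ≡ ⌊ b? ⌋
  ⌊⌋-⇔ A⇔B a? b? = trans (isYes≗does a?) (trans (does-⇔ A⇔B a? b?) (sym (isYes≗does b?)))

  ⌊suc≟suc⌋ : ∀ {k} (s t : Fin k) → ⌊ suc s ≟ suc t ⌋ ≡ ⌊ s ≟ t ⌋
  ⌊suc≟suc⌋ s t = ⌊⌋-⇔ (mk⇔ suc-injective (cong suc)) (suc s ≟ suc t) (s ≟ t)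

  ⌊⌋-true⇒ : ∀ {A : Set} (a? : Dec A) → ⌊ a? ⌋ ≡ true → A
  ⌊⌋-true⇒ a? e = toWitness (Equivalence.from T-≡ e)

  ⌊≟⌋-refl : ∀ {k} (t : Fin k) → ⌊ t ≟ t ⌋ ≡ true
  ⌊≟⌋-refl t = trans (isYes≗does (t ≟ t)) (dec-true (t ≟ t) refl)

  ∨-true : ∀ b c → b ∨ c ≡ true → b ≡ true ⊎ c ≡ true
  ∨-true true  c _ = inj₁ refl
  ∨-true false c p = inj₂ p

  indicator : Bool → ℕ
  indicator b = if b then 1 else 0

  count : ∀ {k} → (Fin k → Bool) → ℕ
  count P = sumFin (indicator ∘ P)

  sumFin-cong : ∀ {k} {f g : Fin k → ℕ} → (∀ i → f i ≡ g i) → sumFin f ≡ sumFin g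
  sumFin-cong {zero}  f≗g = refl
  sumFin-cong {suc k} f≗g = cong₂ _+_ (f≗g zero) (sumFin-cong (f≗g ∘ suc))

  sumFin-mono : ∀ {k} {f g : Fin k → ℕ} → (∀ i → f i ≤ g i) → sumFin f ≤ sumFin g
  sumFin-mono {zero}  f≤g = z≤n
  sumFin-mono {suc k} f≤g = +-mono-≤ (f≤g zero) (sumFin-mono (f≤g ∘ suc))

  sumFin-+ : ∀ {k} (f g : Fin k → ℕ) → sumFin (λ i → f i + g i) ≡ sumFin f + sumFin g
  sumFin-+ {zero}  f g = refl
  sumFin-+ {suc k} f g rewrite sumFin-+ (f ∘ suc) (g ∘ suc) =
    solve 4 (λ a b c d → (a :+ b) :+ (c :+ d) := (a :+ c) :+ (b :+ d)) refl
      (f zero) (g zero) (sumFin (f ∘ suc)) (sumFin (g ∘ suc))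

  count-const : ∀ {k} b → count {k} (λ _ → b) ≡ (if b then k else 0)
  count-const {zero}  true  = refl
  count-const {zero}  false = refl
  count-const {suc k} true  = cong suc (count-const {k} true)
  count-const {suc k} false = count-const {k} false

  count≤size : ∀ {k} (P : Fin k → Bool) → count P ≤ k
  count≤size {zero}  P = z≤n
  count≤size {suc k} P = +-mono-≤ (indicator≤1 (P zero)) (count≤size (P ∘ suc))
    where
    indicator≤1 : ∀ b → indicator b ≤ 1
    indicator≤1 true  = s≤s z≤n
    indicator≤1 false = z≤n

  count-mono : ∀ {k} {P Q : Fin k → Bool} → (∀ i → P i ≡ true → Q i ≡ true) → count P ≤ count Q
  count-mono {P = P} {Q} P⇒Q = sumFin-mono λ i → pointwise (P i) (Q i) (P⇒Q i)
    where
    pointwise : ∀ b c → (b ≡ true → c ≡ true) → indicator b ≤ indicator c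
    pointwise false c _ = z≤n
    pointwise true  c b⇒c rewrite b⇒c refl = ≤-refl

  count-∨ : ∀ {k} (P Q : Fin k → Bool) → count (λ i → P i ∨ Q i) ≤ count P + count Q
  count-∨ P Q = ≤-trans (sumFin-mono λ i → pointwise (P i) (Q i))
                        (≤-reflexive (sumFin-+ (indicator ∘ P) (indicator ∘ Q)))
    where
    pointwise : ∀ b c → indicator (b ∨ c) ≤ indicator b + indicator c
    pointwise false c = ≤-refl
    pointwise true  c = s≤s z≤n

  count-≟ : ∀ {k} (s : Fin k) → count (λ t → ⌊ s ≟ t ⌋) ≡ 1
  count-≟ {suc k} zero    = cong suc (count-const {k} false)
  count-≟ {suc k} (suc s) =
    trans (sumFin-cong λ t → cong indicator (⌊suc≟suc⌋ s t)) (count-≟ s)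

  -- A cover by at most c vertices is given as c slots, each empty or holding a vertex: unlike a
  -- subset, such a family can be pushed forward along the partial vertex maps of minor operations.
  _∈ₛ_ : ∀ {c n} → Fin n → (Fin c → Maybe (Fin n)) → Set
  t ∈ₛ S = ∃ λ l → S l ≡ just t

  Covers : (G : Graph) {c : ℕ} → (Fin c → Maybe (Fin (n G))) → Set
  Covers G S = ∀ i j → edge G i j ≡ true → i ∈ₛ S ⊎ j ∈ₛ S

  holds : ∀ {n} → Maybe (Fin n) → Fin n → Bool
  holds nothing  t = false
  holds (just s) t = ⌊ s ≟ t ⌋

  occursIn : ∀ {c n} → (Fin c → Maybe (Fin n)) → Fin n → Bool
  occursIn {zero}  S t = false
  occursIn {suc c} S t = holds (S zero) t ∨ occursIn (S ∘ suc) t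

  occursIn-complete : ∀ {c n} (S : Fin c → Maybe (Fin n)) {t} → t ∈ₛ S → occursIn S t ≡ true
  occursIn-complete S {t} (zero , S0≡t) rewrite S0≡t | ⌊≟⌋-refl t = refl
  occursIn-complete S {t} (suc l , Sl≡t) with holds (S zero) t
  ... | true  = refl
  ... | false = occursIn-complete (S ∘ suc) (l , Sl≡t)

  count-occursIn : ∀ {c n} (S : Fin c → Maybe (Fin n)) → count (occursIn S) ≤ c
  count-occursIn {zero}  {n} S = ≤-reflexive (count-const {n} false)
  count-occursIn {suc c} S =
    ≤-trans (count-∨ (holds (S zero)) (occursIn (S ∘ suc)))
            (+-mono-≤ (count-holds (S zero)) (count-occursIn (S ∘ suc)))
    where
    count-holds : ∀ {n} (m : Maybe (Fin n)) → count (holds m) ≤ 1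
    count-holds {n} nothing  = ≤-trans (≤-reflexive (count-const {n} false)) z≤n
    count-holds     (just s) = ≤-reflexive (count-≟ s)

  edgeA-comm : ∀ {k} (a : Adj k) i j → edgeA a i j ≡ edgeA a j i
  edgeA-comm a i j =
    cong₂ (λ b c → not b ∧ c) (⌊⌋-⇔ (mk⇔ sym sym) (i ≟ j) (j ≟ i)) (∨-comm (a i j) (a j i))

  edgeA⇒raw : ∀ {k} (a : Adj k) i j → edgeA a i j ≡ true → a i j ≡ true ⊎ a j i ≡ true
  edgeA⇒raw a i j e = ∨-true (a i j) (a j i) (∧-conicalʳ _ _ e)

  edgeA-reindex : ∀ {m k} (a : Adj m) (f : Fin k → Fin m) → (∀ {i j} → f i ≡ f j → i ≡ j) →
                  ∀ i j → edgeA (λ i j → a (f i) (f j)) i j ≡ edgeA a (f i) (f j)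
  edgeA-reindex a f f-inj i j =
    cong (λ b → not b ∧ (a (f i) (f j) ∨ a (f j) (f i)))
         (⌊⌋-⇔ (mk⇔ (cong f) f-inj) (i ≟ j) (f i ≟ f j))

  LiftedEdge : (G H : Graph) → (Fin (n G) → Maybe (Fin (n H))) → Fin (n H) → Fin (n H) → Set
  LiftedEdge G H g i j =
    Σ (Fin (n G)) λ u → Σ (Fin (n G)) λ w → edge G u w ≡ true × g u ≡ just i × g w ≡ just j

  record LiftsEdges (G H : Graph) (g : Fin (n G) → Maybe (Fin (n H))) : Set where
    constructor liftsEdges
    field liftEdge : ∀ i j → edge H i j ≡ true → LiftedEdge G H g i j

  liftsEdges-fromRaw : ∀ G H g → (∀ i j → adj H i j ≡ true → LiftedEdge G H g i j) → LiftsEdges G H g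
  liftsEdges-fromRaw G H g lift = liftsEdges λ i j e → oriented i j (edgeA⇒raw (adj H) i j e)
    where
    oriented : ∀ i j → adj H i j ≡ true ⊎ adj H j i ≡ true → LiftedEdge G H g i j
    oriented i j (inj₁ ij) = lift i j ij
    oriented i j (inj₂ ji) with lift j i ji
    ... | u , w , uw , gu , gw = w , u , trans (edgeA-comm (adj G) w u) uw , gw , gu

  covers-transport : ∀ {G H g c} {S : Fin c → Maybe (Fin (n G))} →
                     LiftsEdges G H g → Covers G S → Covers H (λ l → S l >>= g)
  covers-transport {g = g} {S = S} lifts cov i j e with LiftsEdges.liftEdge lifts i j e
  ... | u , w , uw , gu , gw = map⊎ (image gu) (image gw) (cov u w uw)
    where
    image : ∀ {u t} → g u ≡ just t → u ∈ₛ S → t ∈ₛ (λ l → S l >>= g)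
    image gu (l , Sl≡u) = l , trans (cong (_>>= g) Sl≡u) gu

  covers-dropEmptySlot : ∀ {G c} {S : Fin (suc c) → Maybe (Fin (n G))} (l : Fin (suc c)) →
                         S l ≡ nothing → Covers G S → Covers G (S ∘ punchIn l)
  covers-dropEmptySlot {S = S} l Sl≡∅ cov i j e = map⊎ keep keep (cov i j e)
    where
    keep : ∀ {t} → t ∈ₛ S → t ∈ₛ (S ∘ punchIn l)
    keep (l′ , Sl′≡t) = punchOut l≢l′ , trans (cong S (punchIn-punchOut l≢l′)) Sl′≡t
      where
      l≢l′ : l ≢ l′
      l≢l′ refl with trans (sym Sl≡∅) Sl′≡t
      ... | ()

  without : ∀ {k} → Fin (suc k) → Fin (suc k) → Maybe (Fin k)
  without x s with x ≟ s
  ... | yes _   = nothing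
  ... | no x≢s = just (punchOut x≢s)

  without-self : ∀ {k} (x : Fin (suc k)) → without x x ≡ nothing
  without-self x with x ≟ x
  ... | yes _   = refl
  ... | no x≢x = ⊥-elim (x≢x refl)

  without-punchIn : ∀ {k} (x : Fin (suc k)) i → without x (punchIn x i) ≡ just i
  without-punchIn x i with x ≟ punchIn x i
  ... | yes x≡x′ = ⊥-elim (punchInᵢ≢i x i (sym x≡x′))
  ... | no x≢x′  = cong just (punchIn-injective x _ _ (punchIn-punchOut x≢x′))

  mergeInto : ∀ {k} {x y : Fin (suc k)} → y ≢ x → Fin (suc k) → Maybe (Fin k)
  mergeInto {y = y} y≢x s = just (fromMaybe (punchOut y≢x) (without y s))

  deleteVertex-liftsEdges : ∀ {k} (a : Adj (suc k)) x →
                            LiftsEdges (mkGraph (suc k) a) (deleteVertex a x) (without x)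
  deleteVertex-liftsEdges a x = liftsEdges λ i j e →
    punchIn x i , punchIn x j ,
    trans (sym (edgeA-reindex a (punchIn x) (punchIn-injective x _ _) i j)) e ,
    without-punchIn x i , without-punchIn x j

  deleteEdge-liftsEdges : ∀ {k} (a : Adj k) x y → LiftsEdges (mkGraph k a) (deleteEdge a x y) just
  deleteEdge-liftsEdges a x y =
    liftsEdges-fromRaw (mkGraph _ a) (deleteEdge a x y) just λ i j e →
      i , j , ∧-conicalˡ _ _ e , refl , refl

  contractEdge-liftsEdges : ∀ {k} (a : Adj (suc k)) x y (y≢x : y ≢ x) →
                            LiftsEdges (mkGraph (suc k) a) (contractEdge a x y) (mergeInto y≢x)
  contractEdge-liftsEdges a x y y≢x =
    liftsEdges-fromRaw (mkGraph _ a) (contractEdge a x y) (mergeInto y≢x) lift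
    where
    merge-punchIn : ∀ i → mergeInto y≢x (punchIn y i) ≡ just i
    merge-punchIn i = cong (just ∘ fromMaybe (punchOut y≢x)) (without-punchIn y i)
    merge-y : ∀ {i} → punchIn y i ≡ x → mergeInto y≢x y ≡ just i
    merge-y {i} yi≡x = cong just (trans (cong (fromMaybe (punchOut y≢x)) (without-self y))
      (punchIn-injective y _ _ (trans (punchIn-punchOut y≢x) (sym yi≡x))))
    lift : ∀ i j → adj (contractEdge a x y) i j ≡ true →
           LiftedEdge (mkGraph (suc _) a) (contractEdge a x y) (mergeInto y≢x) i j
    lift i j e with ∨-true (edgeA a (punchIn y i) (punchIn y j)) _ e
    ... | inj₁ e′ = punchIn y i , punchIn y j , e′ , merge-punchIn i , merge-punchIn j
    ... | inj₂ e′ = y , punchIn y j , ∧-conicalʳ ⌊ punchIn y i ≟ x ⌋ _ e′ ,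
                    merge-y (⌊⌋-true⇒ (punchIn y i ≟ x) (∧-conicalˡ _ _ e′)) , merge-punchIn j

  ≅-liftsEdges : ∀ {G H} (iso : G ≅ H) → LiftsEdges G H (just ∘ Inverse.to (proj₁ iso))
  ≅-liftsEdges {G} {H} (f , pres) = liftsEdges λ i j e →
    from i , from j ,
    trans (sym (pres (from i) (from j)))
          (trans (cong₂ (edge H) (inverseˡ refl) (inverseˡ refl)) e) ,
    cong just (inverseˡ refl) , cong just (inverseˡ refl)
    where open Inverse f

  edgeA-irreflexive : ∀ {k} (a : Adj k) x → edgeA a x x ≡ false
  edgeA-irreflexive a x rewrite ⌊≟⌋-refl x = refl

  minorClosed-fromSteps : ∀ (A : Class) → IsoClosed A → (∀ {G H} → MinorStep G H → A G → A H) →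
                          MinorClosed A
  minorClosed-fromSteps A iso step G H (H′ , steps , H′≅H) = iso H′ H H′≅H ∘ along steps
    where
    along : ∀ {G H} → Star MinorStep G H → A G → A H
    along ε        = λ AG → AG
    along (s ◅ ss) = along ss ∘ step s

  BoundedCover : ℕ → ℕ → Class
  BoundedCover N c G = n G ≤ N × Σ (Fin c → Maybe (Fin (n G))) (Covers G)

  boundedCover-isoClosed : ∀ N c → IsoClosed (BoundedCover N c)
  boundedCover-isoClosed N c G H iso (G≤N , S , cov) =
    subst (_≤ N) (↔⇒≡ (proj₁ iso)) G≤N , _ , covers-transport (≅-liftsEdges {G} {H} iso) cov

  boundedCover-step : ∀ {N c G H} → MinorStep G H → BoundedCover N c G → BoundedCover N c H
  boundedCover-step (delV a x) (G≤N , S , cov) =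
    ≤-trans (n≤1+n _) G≤N , _ , covers-transport (deleteVertex-liftsEdges a x) cov
  boundedCover-step (delE a x y _) (G≤N , S , cov) =
    G≤N , _ , covers-transport (deleteEdge-liftsEdges a x y) cov
  boundedCover-step (conE a x y xy) (G≤N , S , cov) =
    ≤-trans (n≤1+n _) G≤N , _ , covers-transport (contractEdge-liftsEdges a x y y≢x) cov
    where
    y≢x : y ≢ x
    y≢x refl with trans (sym xy) (edgeA-irreflexive a x)
    ... | ()

  complete : ℕ → Graph
  complete k = mkGraph k (λ _ _ → true)

  boundedCover-properMinorClosed : ∀ N c → ProperMinorClosed (BoundedCover N c)
  boundedCover-properMinorClosed N c =
    boundedCover-isoClosed N c ,
    ((complete 0 , z≤n , (λ _ → nothing) , λ ()) ,
     (complete (suc N) , λ { (1+N≤N , _) → 1+n≰n 1+N≤N })) ,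
    minorClosed-fromSteps (BoundedCover N c) (boundedCover-isoClosed N c) boundedCover-step

  maxCoveredEdges : ℕ → ℕ → ℕ
  maxCoveredEdges zero    c = 0
  maxCoveredEdges (suc k) c = k ⊓ c + maxCoveredEdges k c

  maxCoveredEdges-sucʳ : ∀ k c →
                         k + maxCoveredEdges k c ≡ k ⊓ suc c + maxCoveredEdges k (suc c)
  maxCoveredEdges-sucʳ zero    c = refl
  maxCoveredEdges-sucʳ (suc k) c rewrite sym (maxCoveredEdges-sucʳ k c) =
    solve 3 (λ k m f → (con 1 :+ k) :+ (m :+ f) := (con 1 :+ m) :+ (k :+ f)) refl
      k (k ⊓ c) (maxCoveredEdges k c)

  degree₀ : ∀ {k} → Adj (suc k) → ℕ
  degree₀ a = count (λ j → edgeA a zero (suc j))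

  e-deleteVertex-zero : ∀ {k} (a : Adj (suc k)) →
    e (mkGraph (suc k) a) ≡ degree₀ a + e (deleteVertex a zero)
  e-deleteVertex-zero a = cong (degree₀ a +_)
    (sumFin-cong λ i → sumFin-cong λ j → cong₂ (λ b c → indicator (b ∧ c))
      (⌊⌋-⇔ (mk⇔ s≤s⁻¹ s≤s) (suc i <? suc j) (i <? j))
      (sym (edgeA-reindex a suc suc-injective i j)))

  EdgeBound : ℕ → Set
  EdgeBound k = ∀ {c} (a : Adj k) (S : Fin c → Maybe (Fin k)) →
                Covers (mkGraph k a) S → e (mkGraph k a) ≤ maxCoveredEdges k c

  degree₀≤k : ∀ {k} (a : Adj (suc k)) → degree₀ a ≤ k
  degree₀≤k a = count≤size _

  edgeBound-suc-covered : ∀ {k} → EdgeBound k →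
                          ∀ {c} (a : Adj (suc k)) (S : Fin c → Maybe (Fin (suc k))) →
                          Covers (mkGraph (suc k) a) S → zero ∈ₛ S →
                          e (mkGraph (suc k) a) ≤ maxCoveredEdges (suc k) c
  edgeBound-suc-covered {k} bound {suc c} a S cov (l , Sl≡0) = begin
    e (mkGraph (suc k) a)                ≡⟨ e-deleteVertex-zero a ⟩
    degree₀ a + e (deleteVertex a zero)  ≤⟨ +-mono-≤ (degree₀≤k a) (bound (adj (deleteVertex a zero)) S₁ cov₁) ⟩
    k + maxCoveredEdges k c              ≡⟨ maxCoveredEdges-sucʳ k c ⟩
    maxCoveredEdges (suc k) (suc c)      ∎
    where
    open ≤-Reasoning
    S₀ : Fin (suc c) → Maybe (Fin k)
    S₀ l = S l >>= without zero
    S₀l≡∅ : S₀ l ≡ nothing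
    S₀l≡∅ = trans (cong (_>>= without zero) Sl≡0) (without-self zero)
    S₁ : Fin c → Maybe (Fin k)
    S₁ = S₀ ∘ punchIn l
    cov₁ : Covers (deleteVertex a zero) S₁
    cov₁ = covers-dropEmptySlot {deleteVertex a zero} l S₀l≡∅
             (covers-transport (deleteVertex-liftsEdges a zero) cov)

  edgeBound-suc-uncovered : ∀ {k} → EdgeBound k →
                            ∀ {c} (a : Adj (suc k)) (S : Fin c → Maybe (Fin (suc k))) →
                            Covers (mkGraph (suc k) a) S → ¬ zero ∈ₛ S →
                            e (mkGraph (suc k) a) ≤ maxCoveredEdges (suc k) c
  edgeBound-suc-uncovered {k} bound {c} a S cov 0∉S = begin
    e (mkGraph (suc k) a)                ≡⟨ e-deleteVertex-zero a ⟩
    degree₀ a + e (deleteVertex a zero)  ≤⟨ +-mono-≤ (⊓-glb (degree₀≤k a) degree₀≤c)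
                                                     (bound (adj (deleteVertex a zero)) S₀ cov₀) ⟩
    maxCoveredEdges (suc k) c            ∎
    where
    open ≤-Reasoning
    neighbour∈S : ∀ j → edgeA a zero (suc j) ≡ true → occursIn S (suc j) ≡ true
    neighbour∈S j e with cov zero (suc j) e
    ... | inj₁ 0∈S  = ⊥-elim (0∉S 0∈S)
    ... | inj₂ j∈S = occursIn-complete S j∈S
    S₀ : Fin c → Maybe (Fin k)
    S₀ l = S l >>= without zero
    cov₀ : Covers (deleteVertex a zero) S₀
    cov₀ = covers-transport (deleteVertex-liftsEdges a zero) cov
    degree₀≤c : degree₀ a ≤ c
    degree₀≤c = ≤-trans (count-mono neighbour∈S)
                       (≤-trans (m≤n+m _ (indicator (occursIn S zero))) (count-occursIn S))

  edgeBound : ∀ k → EdgeBound k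
  edgeBound zero    a S cov = z≤n
  edgeBound (suc k) a S cov with any? (λ l → ≡-dec _≟_ (S l) (just zero))
  ... | yes 0∈S = edgeBound-suc-covered   (edgeBound k) a S cov 0∈S
  ... | no 0∉S  = edgeBound-suc-uncovered (edgeBound k) a S cov 0∉S

  inClique : ∀ t {a} → Fin (t + a) → Bool
  inClique zero    i       = true
  inClique (suc t) zero    = false
  inClique (suc t) (suc i) = inClique t i

  -- The last a vertices form a clique joined to every vertex; the first t are independent.
  completeSplit : ℕ → ℕ → Graph
  completeSplit t a = mkGraph (t + a) (λ i _ → inClique t i)

  inClique⇒↑ʳ : ∀ t {a} (i : Fin (t + a)) → inClique t i ≡ true → ∃ λ l → t ↑ʳ l ≡ i
  inClique⇒↑ʳ zero    i       _ = i , refl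
  inClique⇒↑ʳ (suc t) (suc i) p with inClique⇒↑ʳ t i p
  ... | l , t↑l≡i = l , cong suc t↑l≡i

  completeSplit-covers : ∀ t a → Covers (completeSplit t a) (λ l → just (t ↑ʳ l))
  completeSplit-covers t a i j e = map⊎ inCover inCover (edgeA⇒raw _ i j e)
    where
    inCover : ∀ {i} → inClique t i ≡ true → i ∈ₛ (λ l → just (t ↑ʳ l))
    inCover {i} p with inClique⇒↑ʳ t i p
    ... | l , t↑l≡i = l , cong just t↑l≡i

  count-inClique : ∀ t {a} → count (inClique t {a}) ≡ a
  count-inClique zero    {a} = count-const {a} true
  count-inClique (suc t)     = count-inClique t

  e-complete : ∀ {k c} → k ≤ c → e (complete k) ≡ maxCoveredEdges k c
  e-complete {zero}      _   = refl
  e-complete {suc k} {c} 1+k≤c = begin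
    e (complete (suc k))                     ≡⟨ e-deleteVertex-zero (adj (complete (suc k))) ⟩
    count {k} (λ _ → true) + e (complete k)  ≡⟨ cong₂ _+_ (count-const {k} true) (e-complete k≤c) ⟩
    k + maxCoveredEdges k c                  ≡⟨ cong (_+ maxCoveredEdges k c) (sym (m≤n⇒m⊓n≡m k≤c)) ⟩
    maxCoveredEdges (suc k) c                ∎
    where
    open ≡-Reasoning
    k≤c : k ≤ c
    k≤c = ≤-trans (n≤1+n k) 1+k≤c

  e-completeSplit : ∀ t a → e (completeSplit t a) ≡ maxCoveredEdges (t + a) a
  e-completeSplit zero    a = e-complete {a} ≤-refl
  e-completeSplit (suc t) a = begin
    e (completeSplit (suc t) a)                 ≡⟨ e-deleteVertex-zero (adj (completeSplit (suc t) a)) ⟩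
    count (inClique t) + e (completeSplit t a)  ≡⟨ cong₂ _+_ (count-inClique t) (e-completeSplit t a) ⟩
    a + maxCoveredEdges (t + a) a               ≡⟨ cong (_+ maxCoveredEdges (t + a) a) a≡[t+a]⊓a ⟩
    maxCoveredEdges (suc t + a) a               ∎
    where
    open ≡-Reasoning
    a≡[t+a]⊓a : a ≡ (t + a) ⊓ a
    a≡[t+a]⊓a = sym (m≥n⇒m⊓n≡n (m≤n+m a t))

  maxCoveredEdges-saturated : ∀ {k c} → k ≤ c → 2 * maxCoveredEdges k c + k ≡ k * k
  maxCoveredEdges-saturated {zero}      _   = refl
  maxCoveredEdges-saturated {suc k} {c} 1+k≤c = begin
    2 * (k ⊓ c + f) + suc k     ≡⟨ cong (λ m → 2 * (m + f) + suc k) (m≤n⇒m⊓n≡m k≤c) ⟩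
    2 * (k + f) + suc k         ≡⟨ solve 2 (λ k f → con 2 :* (k :+ f) :+ (con 1 :+ k)
                                                   := (con 2 :* f :+ k) :+ (con 1 :+ con 2 :* k)) refl k f ⟩
    (2 * f + k) + (1 + 2 * k)   ≡⟨ cong (_+ (1 + 2 * k)) (maxCoveredEdges-saturated k≤c) ⟩
    k * k + (1 + 2 * k)         ≡⟨ solve 1 (λ k → k :* k :+ (con 1 :+ con 2 :* k)
                                                 := (con 1 :+ k) :* (con 1 :+ k)) refl k ⟩
    suc k * suc k               ∎
    where
    open ≡-Reasoning
    f : ℕ
    f = maxCoveredEdges k c
    k≤c : k ≤ c
    k≤c = ≤-trans (n≤1+n k) 1+k≤c

  maxCoveredEdges-closedForm : ∀ d a →
                               2 * maxCoveredEdges (d + a) a + a * suc a ≡ 2 * a * (d + a)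
  maxCoveredEdges-closedForm zero a = begin
    2 * maxCoveredEdges a a + a * suc a    ≡⟨ solve 2 (λ f a → con 2 :* f :+ a :* (con 1 :+ a)
                                                       := (con 2 :* f :+ a) :+ a :* a) refl (maxCoveredEdges a a) a ⟩
    (2 * maxCoveredEdges a a + a) + a * a  ≡⟨ cong (_+ a * a) (maxCoveredEdges-saturated {a} ≤-refl) ⟩
    a * a + a * a                          ≡⟨ solve 1 (λ a → a :* a :+ a :* a := con 2 :* a :* a) refl a ⟩
    2 * a * a                              ∎
    where open ≡-Reasoning
  maxCoveredEdges-closedForm (suc d) a = begin
    2 * ((d + a) ⊓ a + f) + a * suc a  ≡⟨ cong (λ m → 2 * (m + f) + a * suc a) (sym a≡[d+a]⊓a) ⟩
    2 * (a + f) + a * suc a            ≡⟨ solve 3 (λ a f s → con 2 :* (a :+ f) :+ s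
                                                   := con 2 :* a :+ (con 2 :* f :+ s)) refl a f (a * suc a) ⟩
    2 * a + (2 * f + a * suc a)        ≡⟨ cong (2 * a +_) (maxCoveredEdges-closedForm d a) ⟩
    2 * a + 2 * a * (d + a)            ≡⟨ solve 2 (λ a d → con 2 :* a :+ con 2 :* a :* (d :+ a)
                                                   := con 2 :* a :* (con 1 :+ d :+ a)) refl a d ⟩
    2 * a * (suc d + a)                ∎
    where
    open ≡-Reasoning
    f : ℕ
    f = maxCoveredEdges (d + a) a
    a≡[d+a]⊓a : a ≡ (d + a) ⊓ a
    a≡[d+a]⊓a = sym (m≥n⇒m⊓n≡n (m≤n+m a d))

  maxCoveredEdges≤ : ∀ v a → maxCoveredEdges v a ≤ v * (v ⊓ a)
  maxCoveredEdges≤ zero    a = z≤n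
  maxCoveredEdges≤ (suc v) a =
    ≤-trans (+-monoʳ-≤ (v ⊓ a) (maxCoveredEdges≤ v a)) (*-monoʳ-≤ (suc v) (⊓-monoˡ-≤ a (n≤1+n v)))

  maxCoveredEdges-density-suc : ∀ v a →
                                maxCoveredEdges v a * suc v ≤ maxCoveredEdges (suc v) a * v
  maxCoveredEdges-density-suc v a = begin
    f * suc v                     ≡⟨ *-comm f (suc v) ⟩
    f + v * f                     ≤⟨ +-monoˡ-≤ (v * f) (maxCoveredEdges≤ v a) ⟩
    v * (v ⊓ a) + v * f           ≡⟨ sym (*-distribˡ-+ v (v ⊓ a) f) ⟩
    v * (v ⊓ a + f)               ≡⟨ *-comm v _ ⟩
    maxCoveredEdges (suc v) a * v ∎
    where
    open ≤-Reasoning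
    f : ℕ
    f = maxCoveredEdges v a

  -- The increments k ⊓ a are nondecreasing, so the averages maxCoveredEdges v a / v are too.
  maxCoveredEdges-density-mono : ∀ a {v w} → v ≤ w →
                                 maxCoveredEdges v a * w ≤ maxCoveredEdges w a * v
  maxCoveredEdges-density-mono a {w = zero}  z≤n = z≤n
  maxCoveredEdges-density-mono a {v} {suc w} v≤1+w with m≤n⇒m<n∨m≡n v≤1+w
  ... | inj₂ refl              = ≤-refl
  ... | inj₁ (s≤s z≤n)         = z≤n
  ... | inj₁ (s≤s v≤w@(s≤s _)) = *-cancelʳ-≤ (f v * suc w) (f (suc w) * v) w (begin
    f v * suc w * w    ≡⟨ *-middle-swap (f v) (suc w) w ⟩
    f v * w * suc w    ≤⟨ *-monoˡ-≤ (suc w) (maxCoveredEdges-density-mono a v≤w) ⟩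
    f w * v * suc w    ≡⟨ *-middle-swap (f w) v (suc w) ⟩
    f w * suc w * v    ≤⟨ *-monoˡ-≤ v (maxCoveredEdges-density-suc w a) ⟩
    f (suc w) * w * v  ≡⟨ *-middle-swap (f (suc w)) w v ⟩
    f (suc w) * v * w  ∎)
    where
    open ≤-Reasoning
    f : ℕ → ℕ
    f k = maxCoveredEdges k a
    *-middle-swap : ∀ x y z → x * y * z ≡ x * z * y
    *-middle-swap x y z = solve 3 (λ x y z → x :* y :* z := x :* z :* y) refl x y z

-- r = a q − p lies in [1, q], and F / N > p / q exactly when 2 r N > a (a + 1) q; N is the least such.
module Parameters (p d : ℕ) where

  open VertexCovers using (maxCoveredEdges; maxCoveredEdges-closedForm; maxCoveredEdges-density-mono)
  open import Data.Nat using (ℕ; suc; _+_; _*_; _∸_; _≤_; _<_; z≤n; s≤s; s≤s⁻¹; _/_; _%_)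
  open import Data.Nat.Properties
  open import Data.Nat.DivMod using (m≡m%n+[m/n]*n; m%n<n; m/n*n≤m)
  open import Relation.Binary.PropositionalEquality
  open import Data.Nat.Solver using (module +-*-Solver)
  open +-*-Solver using (solve; _:+_; _:*_; _:=_; con)

  q a r M N F : ℕ
  q = suc d
  a = suc (p / q)
  r = suc (d ∸ p % q)
  M = a * suc a * q
  N = suc (M / (2 * r))
  F = maxCoveredEdges N a

  a*q≡p+r : a * q ≡ p + r
  a*q≡p+r = begin
    q + p / q * q                          ≡⟨ cong (λ m → suc m + p / q * q) (sym (m+[n∸m]≡n p%q≤d)) ⟩
    suc (p % q + (d ∸ p % q)) + p / q * q  ≡⟨ solve 3 (λ s t u → (con 1 :+ (s :+ t)) :+ u := (s :+ u) :+ (con 1 :+ t))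
                                                refl (p % q) (d ∸ p % q) (p / q * q) ⟩
    (p % q + p / q * q) + r                ≡⟨ cong (_+ r) (sym (m≡m%n+[m/n]*n p q)) ⟩
    p + r                                  ∎
    where
    open ≡-Reasoning
    p%q≤d : p % q ≤ d
    p%q≤d = s≤s⁻¹ (m%n<n p q)

  r≤q : r ≤ q
  r≤q = s≤s (m∸n≤m d (p % q))

  M<N*[2*r] : M < N * (2 * r)
  M<N*[2*r] = begin-strict
    M                                    ≡⟨ m≡m%n+[m/n]*n M (2 * r) ⟩
    M % (2 * r) + M / (2 * r) * (2 * r)  <⟨ +-monoˡ-< (M / (2 * r) * (2 * r)) (m%n<n M (2 * r)) ⟩
    N * (2 * r)                          ∎
    where open ≤-Reasoning

  a*[1+a]<2*N : a * suc a < 2 * N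
  a*[1+a]<2*N = *-cancelʳ-< q (a * suc a) (2 * N) (begin-strict
    a * suc a * q  <⟨ M<N*[2*r] ⟩
    N * (2 * r)    ≤⟨ *-monoʳ-≤ N (*-monoʳ-≤ 2 r≤q) ⟩
    N * (2 * q)    ≡⟨ solve 2 (λ n q → n :* (con 2 :* q) := con 2 :* n :* q) refl N q ⟩
    2 * N * q      ∎)
    where open ≤-Reasoning

  a≤N : a ≤ N
  a≤N = *-cancelˡ-≤ 2 (<⇒≤ (begin-strict
    2 * a      ≡⟨ *-comm 2 a ⟩
    a * 2      ≤⟨ *-monoʳ-≤ a (s≤s (s≤s z≤n)) ⟩
    a * suc a  <⟨ a*[1+a]<2*N ⟩
    2 * N      ∎))
    where open ≤-Reasoning

  2*[q*F]+M≡2*[p*N]+N*[2*r] : 2 * (q * F) + M ≡ 2 * (p * N) + N * (2 * r)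
  2*[q*F]+M≡2*[p*N]+N*[2*r] = begin
    2 * (q * F) + M            ≡⟨ solve 3 (λ q f s → con 2 :* (q :* f) :+ s :* q := q :* (con 2 :* f :+ s))
                                      refl q F (a * suc a) ⟩
    q * (2 * F + a * suc a)    ≡⟨ cong (q *_) closedForm ⟩
    q * (2 * a * N)            ≡⟨ solve 3 (λ q a n → q :* (con 2 :* a :* n) := con 2 :* n :* (a :* q)) refl q a N ⟩
    2 * N * (a * q)            ≡⟨ cong (2 * N *_) a*q≡p+r ⟩
    2 * N * (p + r)            ≡⟨ solve 3 (λ n p r → con 2 :* n :* (p :+ r) := con 2 :* (p :* n) :+ n :* (con 2 :* r))
                                      refl N p r ⟩
    2 * (p * N) + N * (2 * r)  ∎
    where
    open ≡-Reasoning
    closedForm : 2 * F + a * suc a ≡ 2 * a * N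
    closedForm = subst (λ m → 2 * maxCoveredEdges m a + a * suc a ≡ 2 * a * m) (m∸n+n≡m a≤N)
                       (maxCoveredEdges-closedForm (N ∸ a) a)

  p*N<q*F : p * N < q * F
  p*N<q*F = *-cancelˡ-< 2 (p * N) (q * F) (+-cancelʳ-< M (2 * (p * N)) (2 * (q * F)) (begin-strict
    2 * (p * N) + M            <⟨ +-monoʳ-< (2 * (p * N)) M<N*[2*r] ⟩
    2 * (p * N) + N * (2 * r)  ≡⟨ sym 2*[q*F]+M≡2*[p*N]+N*[2*r] ⟩
    2 * (q * F) + M            ∎))
    where open ≤-Reasoning

  F*q≤p*N+q : F * q ≤ p * N + q
  F*q≤p*N+q = *-cancelˡ-≤ 2 (+-cancelʳ-≤ M (2 * (F * q)) (2 * (p * N + q)) (begin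
    2 * (F * q) + M                                ≡⟨ cong (λ m → 2 * m + M) (*-comm F q) ⟩
    2 * (q * F) + M                                ≡⟨ 2*[q*F]+M≡2*[p*N]+N*[2*r] ⟩
    2 * (p * N) + (2 * r + M / (2 * r) * (2 * r))  ≤⟨ +-monoʳ-≤ (2 * (p * N)) (+-mono-≤ (*-monoʳ-≤ 2 r≤q) (m/n*n≤m M (2 * r))) ⟩
    2 * (p * N) + (2 * q + M)                      ≡⟨ solve 3 (λ s q m → con 2 :* s :+ (con 2 :* q :+ m) := con 2 :* (s :+ q) :+ m)
                                                          refl (p * N) q M ⟩
    2 * (p * N + q) + M                            ∎))
    where open ≤-Reasoning

  p*p≤2*N*[q*q] : p * p ≤ 2 * N * (q * q)
  p*p≤2*N*[q*q] = begin
    p * p                  ≤⟨ *-mono-≤ p≤a*q p≤a*q ⟩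
    (a * q) * (a * q)      ≡⟨ solve 2 (λ a q → (a :* q) :* (a :* q) := (a :* a) :* (q :* q)) refl a q ⟩
    (a * a) * (q * q)      ≤⟨ *-monoˡ-≤ (q * q) (*-monoʳ-≤ a (n≤1+n a)) ⟩
    (a * suc a) * (q * q)  ≤⟨ *-monoˡ-≤ (q * q) (<⇒≤ a*[1+a]<2*N) ⟩
    2 * N * (q * q)        ∎
    where
    open ≤-Reasoning
    p≤a*q : p ≤ a * q
    p≤a*q = ≤-trans (m≤m+n p r) (≤-reflexive (sym a*q≡p+r))

  -- E / v ≤ F / N ≤ x + 1 / N ≤ x + 2 / x² for x = p / q, cleared of denominators.
  density-gap : ∀ {v E} → v ≤ N → E ≤ maxCoveredEdges v a →
                E * (p * p * q) ≤ (p * p * p + 2 * (q * q * q)) * v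
  density-gap {v} {E} v≤N E≤f = *-cancelʳ-≤ (E * (p * p * q)) ((p * p * p + 2 * (q * q * q)) * v) N (begin
    E * (p * p * q) * N                  ≤⟨ *-monoˡ-≤ N (*-monoˡ-≤ (p * p * q) E≤f) ⟩
    f * (p * p * q) * N                  ≡⟨ solve 3 (λ f s n → f :* s :* n := (f :* n) :* s) refl f (p * p * q) N ⟩
    (f * N) * (p * p * q)                ≤⟨ *-monoˡ-≤ (p * p * q) (maxCoveredEdges-density-mono a v≤N) ⟩
    (F * v) * (p * p * q)                ≡⟨ solve 4 (λ f v p q → (f :* v) :* (p :* p :* q) := (f :* q) :* (v :* (p :* p)))
                                                 refl F v p q ⟩
    (F * q) * (v * (p * p))              ≤⟨ *-monoˡ-≤ (v * (p * p)) F*q≤p*N+q ⟩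
    (p * N + q) * (v * (p * p))          ≡⟨ solve 4 (λ p n q v → (p :* n :+ q) :* (v :* (p :* p))
                                                   := p :* p :* p :* v :* n :+ q :* v :* (p :* p)) refl p N q v ⟩
    p * p * p * v * N + q * v * (p * p)  ≤⟨ +-monoʳ-≤ (p * p * p * v * N) (*-monoʳ-≤ (q * v) p*p≤2*N*[q*q]) ⟩
    p * p * p * v * N + q * v * (2 * N * (q * q))
      ≡⟨ solve 4 (λ p n q v → p :* p :* p :* v :* n :+ q :* v :* (con 2 :* n :* (q :* q))
                              := (p :* p :* p :+ con 2 :* (q :* q :* q)) :* v :* n) refl p N q v ⟩
    (p * p * p + 2 * (q * q * q)) * v * N ∎)
    where
    open ≤-Reasoning
    f : ℕ
    f = maxCoveredEdges v a

module NatEmbedding where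

  import Data.Nat as ℕ
  import Data.Nat.Properties as ℕ
  open import Data.Integer using (+_)
  import Data.Integer as ℤ
  import Data.Integer.Properties as ℤ
  open import Data.Rational using (mkℚ; _+_; _*_; _≤_; _<_; toℚᵘ)
  open import Data.Rational.Properties
    using (toℚᵘ-fromℚᵘ; toℚᵘ-cancel-≤; toℚᵘ-cancel-<; toℚᵘ-injective; toℚᵘ-homo-+; toℚᵘ-homo-*)
  open import Data.Rational.Unnormalised as ℚᵘ using (mkℚᵘ; _≃_; *≡*; *≤*; *<*)
  import Data.Rational.Unnormalised.Properties as ℚᵘ
  open import Relation.Binary.PropositionalEquality

  toℚᵘ-ℕ→ℚ : ∀ m → toℚᵘ (ℕ→ℚ m) ≃ mkℚᵘ (+ m) 0
  toℚᵘ-ℕ→ℚ m = toℚᵘ-fromℚᵘ (mkℚᵘ (+ m) 0)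

  ℕ→ℚ-mono-≤ : ∀ {m n} → m ℕ.≤ n → ℕ→ℚ m ≤ ℕ→ℚ n
  ℕ→ℚ-mono-≤ {m} {n} m≤n = toℚᵘ-cancel-≤
    (ℚᵘ.≤-respˡ-≃ (ℚᵘ.≃-sym (toℚᵘ-ℕ→ℚ m)) (ℚᵘ.≤-respʳ-≃ (ℚᵘ.≃-sym (toℚᵘ-ℕ→ℚ n))
      (*≤* (subst₂ ℤ._≤_ (sym (ℤ.*-identityʳ (+ m))) (sym (ℤ.*-identityʳ (+ n))) (ℤ.+≤+ m≤n)))))

  ℕ→ℚ-mono-< : ∀ {m n} → m ℕ.< n → ℕ→ℚ m < ℕ→ℚ n
  ℕ→ℚ-mono-< {m} {n} m<n = toℚᵘ-cancel-<
    (ℚᵘ.<-respˡ-≃ (ℚᵘ.≃-sym (toℚᵘ-ℕ→ℚ m)) (ℚᵘ.<-respʳ-≃ (ℚᵘ.≃-sym (toℚᵘ-ℕ→ℚ n))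
      (*<* (subst₂ ℤ._<_ (sym (ℤ.*-identityʳ (+ m))) (sym (ℤ.*-identityʳ (+ n))) (ℤ.+<+ m<n)))))

  ℕ→ℚ-homo-+ : ∀ m n → ℕ→ℚ (m ℕ.+ n) ≡ ℕ→ℚ m + ℕ→ℚ n
  ℕ→ℚ-homo-+ m n = toℚᵘ-injective (ℚᵘ.≃-trans (toℚᵘ-ℕ→ℚ (m ℕ.+ n)) (ℚᵘ.≃-trans integral
    (ℚᵘ.≃-sym (ℚᵘ.≃-trans (toℚᵘ-homo-+ (ℕ→ℚ m) (ℕ→ℚ n)) (ℚᵘ.+-cong (toℚᵘ-ℕ→ℚ m) (toℚᵘ-ℕ→ℚ n))))))
    where
    integral : mkℚᵘ (+ (m ℕ.+ n)) 0 ≃ mkℚᵘ (+ m) 0 ℚᵘ.+ mkℚᵘ (+ n) 0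
    integral = *≡* (trans (ℤ.*-identityʳ _) (trans (ℤ.pos-+ m n)
      (trans (cong₂ ℤ._+_ (sym (ℤ.*-identityʳ (+ m))) (sym (ℤ.*-identityʳ (+ n)))) (sym (ℤ.*-identityʳ _)))))

  ℕ→ℚ-homo-* : ∀ m n → ℕ→ℚ (m ℕ.* n) ≡ ℕ→ℚ m * ℕ→ℚ n
  ℕ→ℚ-homo-* m n = toℚᵘ-injective (ℚᵘ.≃-trans (toℚᵘ-ℕ→ℚ (m ℕ.* n)) (ℚᵘ.≃-trans integral
    (ℚᵘ.≃-sym (ℚᵘ.≃-trans (toℚᵘ-homo-* (ℕ→ℚ m) (ℕ→ℚ n)) (ℚᵘ.*-cong (toℚᵘ-ℕ→ℚ m) (toℚᵘ-ℕ→ℚ n))))))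
    where
    integral : mkℚᵘ (+ (m ℕ.* n)) 0 ≃ mkℚᵘ (+ m) 0 ℚᵘ.* mkℚᵘ (+ n) 0
    integral = *≡* (cong (ℤ._* + 1) (ℤ.pos-* m n))

  ℕ→ℚ-homo-*³ : ∀ l m n → ℕ→ℚ (l ℕ.* m ℕ.* n) ≡ ℕ→ℚ l * ℕ→ℚ m * ℕ→ℚ n
  ℕ→ℚ-homo-*³ l m n = trans (ℕ→ℚ-homo-* (l ℕ.* m) n) (cong (_* ℕ→ℚ n) (ℕ→ℚ-homo-* l m))

  mkℚ-*-denominator : ∀ p d .(c : Coprime p (ℕ.suc d)) → mkℚ (+ p) d c * ℕ→ℚ (ℕ.suc d) ≡ ℕ→ℚ p
  mkℚ-*-denominator p d c = toℚᵘ-injective (ℚᵘ.≃-trans (toℚᵘ-homo-* (mkℚ (+ p) d c) (ℕ→ℚ (ℕ.suc d)))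
    (ℚᵘ.≃-trans (ℚᵘ.*-cong (ℚᵘ.≃-refl {mkℚᵘ (+ p) d}) (toℚᵘ-ℕ→ℚ (ℕ.suc d)))
      (ℚᵘ.≃-trans cancel (ℚᵘ.≃-sym (toℚᵘ-ℕ→ℚ p)))))
    where
    cancel : mkℚᵘ (+ p) d ℚᵘ.* mkℚᵘ (+ ℕ.suc d) 0 ≃ mkℚᵘ (+ p) 0
    cancel = *≡* (trans (ℤ.*-identityʳ _) (cong (λ m → + p ℤ.* + m) (sym (ℕ.*-identityʳ (ℕ.suc d)))))

module RationalDensity (p d : ℕ) .(coprime : Coprime p (suc d)) where

  open VertexCovers
    using (BoundedCover; maxCoveredEdges; completeSplit; completeSplit-covers; e-completeSplit; edgeBound)
  open Parameters p d
  open NatEmbedding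
  import Data.Nat as ℕ
  import Data.Nat.Properties as ℕ
  open import Data.Fin using (_↑ʳ_)
  open import Data.Integer using (+_)
  open import Data.Maybe using (just)
  open import Data.Product using (_,_)
  open import Data.Rational using (ℚ; mkℚ; _+_; _*_; _≤_; _<_; Positive; NonNegative; positive; nonNegative)
  open import Data.Rational.Properties using (*-cancelˡ-<-nonNeg; *-cancelʳ-≤-pos)
  open import Data.Rational.Solver using (module +-*-Solver)
  open +-*-Solver using (solve; _:+_; _:*_; _:=_)
  open import Relation.Binary.PropositionalEquality

  x : ℚ
  x = mkℚ (+ p) d coprime

  x*q≡p : x * ℕ→ℚ q ≡ ℕ→ℚ p
  x*q≡p = mkℚ-*-denominator p d coprime

  x*N<F : x * ℕ→ℚ N < ℕ→ℚ F
  x*N<F = *-cancelˡ-<-nonNeg (ℕ→ℚ q) (subst₂ _<_ scale (ℕ→ℚ-homo-* q F) (ℕ→ℚ-mono-< p*N<q*F))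
    where
    open ≡-Reasoning
    instance
      q≥0 : NonNegative (ℕ→ℚ q)
      q≥0 = nonNegative (ℕ→ℚ-mono-≤ {0} {q} ℕ.z≤n)
    scale : ℕ→ℚ (p ℕ.* N) ≡ ℕ→ℚ q * (x * ℕ→ℚ N)
    scale = begin
      ℕ→ℚ (p ℕ.* N)        ≡⟨ ℕ→ℚ-homo-* p N ⟩
      ℕ→ℚ p * ℕ→ℚ N        ≡⟨ cong (_* ℕ→ℚ N) (sym x*q≡p) ⟩
      x * ℕ→ℚ q * ℕ→ℚ N    ≡⟨ solve 3 (λ x q n → x :* q :* n := q :* (x :* n)) refl x (ℕ→ℚ q) (ℕ→ℚ N) ⟩
      ℕ→ℚ q * (x * ℕ→ℚ N)  ∎

  completeSplit-dense : CritAbove (BoundedCover N a) x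
  completeSplit-dense =
    completeSplit (N ℕ.∸ a) a ,
    (ℕ.≤-reflexive size≡N , (λ l → just ((N ℕ.∸ a) ↑ʳ l)) , completeSplit-covers (N ℕ.∸ a) a) ,
    subst₂ (λ v m → x * ℕ→ℚ v < ℕ→ℚ m) (sym size≡N) (sym edges≡F) x*N<F
    where
    size≡N : N ℕ.∸ a ℕ.+ a ≡ N
    size≡N = ℕ.m∸n+n≡m a≤N
    edges≡F : e (completeSplit (N ℕ.∸ a) a) ≡ F
    edges≡F = trans (e-completeSplit (N ℕ.∸ a) a) (cong (λ v → maxCoveredEdges v a) size≡N)

  boundedCover-gap : ∀ G → BoundedCover N a G →
                     ℕ→ℚ (e G) * (x * x) ≤ (x * (x * x) + ℕ→ℚ 2) * ℕ→ℚ (v G)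
  boundedCover-gap G (G≤N , S , cov) =
    *-cancelʳ-≤-pos (↑ q³) (subst₂ _≤_ lhs rhs (ℕ→ℚ-mono-≤ (density-gap G≤N edges≤)))
    where
    open ≡-Reasoning
    ↑ : ℕ → ℚ
    ↑ = ℕ→ℚ
    q³ : ℕ
    q³ = q ℕ.* q ℕ.* q
    instance
      q³>0 : Positive (↑ q³)
      q³>0 = positive (ℕ→ℚ-mono-< {0} {q³} (ℕ.s≤s ℕ.z≤n))
    edges≤ : e G ℕ.≤ maxCoveredEdges (v G) a
    edges≤ = edgeBound (n G) (adj G) S cov
    lhs : ↑ (e G ℕ.* (p ℕ.* p ℕ.* q)) ≡ ↑ (e G) * (x * x) * ↑ q³
    lhs = begin
      ↑ (e G ℕ.* (p ℕ.* p ℕ.* q))              ≡⟨ trans (ℕ→ℚ-homo-* (e G) (p ℕ.* p ℕ.* q))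
                                                         (cong (↑ (e G) *_) (ℕ→ℚ-homo-*³ p p q)) ⟩
      ↑ (e G) * (↑ p * ↑ p * ↑ q)              ≡⟨ cong (λ y → ↑ (e G) * (y * y * ↑ q)) (sym x*q≡p) ⟩
      ↑ (e G) * ((x * ↑ q) * (x * ↑ q) * ↑ q)  ≡⟨ solve 3 (λ m x q → m :* ((x :* q) :* (x :* q) :* q)
                                                                := m :* (x :* x) :* (q :* q :* q)) refl (↑ (e G)) x (↑ q) ⟩
      ↑ (e G) * (x * x) * (↑ q * ↑ q * ↑ q)    ≡⟨ cong (↑ (e G) * (x * x) *_) (sym (ℕ→ℚ-homo-*³ q q q)) ⟩
      ↑ (e G) * (x * x) * ↑ q³                 ∎
    rhs : ↑ ((p ℕ.* p ℕ.* p ℕ.+ 2 ℕ.* q³) ℕ.* v G) ≡ (x * (x * x) + ↑ 2) * ↑ (v G) * ↑ q³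
    rhs = begin
      ↑ ((p ℕ.* p ℕ.* p ℕ.+ 2 ℕ.* q³) ℕ.* v G)
        ≡⟨ trans (ℕ→ℚ-homo-* (p ℕ.* p ℕ.* p ℕ.+ 2 ℕ.* q³) (v G))
             (cong (_* ↑ (v G)) (trans (ℕ→ℚ-homo-+ (p ℕ.* p ℕ.* p) (2 ℕ.* q³))
               (cong₂ _+_ (ℕ→ℚ-homo-*³ p p p) (ℕ→ℚ-homo-* 2 q³)))) ⟩
      (↑ p * ↑ p * ↑ p + ↑ 2 * ↑ q³) * ↑ (v G)
        ≡⟨ cong₂ (λ y z → (y * y * y + ↑ 2 * z) * ↑ (v G)) (sym x*q≡p) (ℕ→ℚ-homo-*³ q q q) ⟩
      ((x * ↑ q) * (x * ↑ q) * (x * ↑ q) + ↑ 2 * (↑ q * ↑ q * ↑ q)) * ↑ (v G)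
        ≡⟨ solve 4 (λ x q c w → ((x :* q) :* (x :* q) :* (x :* q) :+ c :* (q :* q :* q)) :* w
                                := (x :* (x :* x) :+ c) :* w :* (q :* q :* q)) refl x (↑ q) (↑ 2) (↑ (v G)) ⟩
      (x * (x * x) + ↑ 2) * ↑ (v G) * (↑ q * ↑ q * ↑ q)
        ≡⟨ cong ((x * (x * x) + ↑ 2) * ↑ (v G) *_) (sym (ℕ→ℚ-homo-*³ q q q)) ⟩
      (x * (x * x) + ↑ 2) * ↑ (v G) * ↑ q³
        ∎

open import Data.Integer using (+_; -[1+_])
open import Data.Product using (Σ; _×_; _,_)
open import Data.Rational using (ℚ; mkℚ; 0ℚ; 1ℚ; _+_; _*_; _≤_; _<_; *≤*; nonNegative)
open import Data.Rational.Properties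
  using (≤-trans; <⇒≤; +-monoʳ-≤; +-monoˡ-≤; *-monoʳ-≤-nonNeg; +-identityʳ; nonNeg*nonNeg⇒nonNeg)
open import Relation.Binary.PropositionalEquality using (subst)
open VertexCovers using (BoundedCover; boundedCover-properMinorClosed)
open NatEmbedding using (ℕ→ℚ-mono-<; ℕ→ℚ-mono-≤)

0<1 : 0ℚ < 1ℚ
0<1 = ℕ→ℚ-mono-< {0} {1} (s≤s z≤n)

classAboveWithinGap : ∀ (x ε : ℚ) → 1ℚ ≤ x → 0ℚ < ε →
                      Σ Class λ A → ProperMinorClosed A × CritAbove A x × CritWithinGap A x ε (ℕ→ℚ 2)
classAboveWithinGap (mkℚ -[1+ _ ] _ _) _ (*≤* ()) _
classAboveWithinGap (mkℚ (+ p) d coprime) ε _ 0<ε =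
  BoundedCover N a , boundedCover-properMinorClosed N a , completeSplit-dense ,
  λ G AG → ≤-trans (boundedCover-gap G AG) (slack (v G))
  where
  open Parameters p d using (N; a)
  open RationalDensity p d coprime using (x; completeSplit-dense; boundedCover-gap)
  slack : ∀ m → (x * (x * x) + ℕ→ℚ 2) * ℕ→ℚ m ≤ ((x + ε) * (x * x) + ℕ→ℚ 2) * ℕ→ℚ m
  slack m = *-monoʳ-≤-nonNeg (ℕ→ℚ m) {{nonNegative (ℕ→ℚ-mono-≤ {0} {m} z≤n)}}
    (+-monoˡ-≤ (ℕ→ℚ 2) (*-monoʳ-≤-nonNeg (x * x) {{nonNeg*nonNeg⇒nonNeg x x}}
      (subst (_≤ x + ε) (+-identityʳ x) (+-monoʳ-≤ x (<⇒≤ 0<ε)))))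

theorem2 : Σ ℚ λ C → Σ ℚ λ X → 0ℚ < X × (∀ (x ε : ℚ) → X ≤ x → 0ℚ < ε → Σ Class λ A → ProperMinorClosed A × CritAbove A x × CritWithinGap A x ε C)
theorem2 = ℕ→ℚ 2 , 1ℚ , 0<1 , classAboveWithinGap
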